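{- Let $\alpha>0$ be rational and let $M=\{(d,c)\in\mathbb{Z}^2: 0\le c\le \alpha d,\ c\neq 1\}$, a commutative monoid under addition. Let $(d,c)$ be an irreducible element of $M$. Then every element $(d,c')\in M$ with $c'>c$ has a unique atomic decomposition, i.e. it can be written as a sum of irreducible elements of $M$ in exactly one way up to the order of the summands.
   Context: An element of $M$ is irreducible if it is nonzero and cannot be written as a sum of two nonzero elements of $M$. -}

module Defs where

open import Data.Integer using (ℤ; +_; _≤_; _<_) renaming (_+_ to _+ℤ_)
open import Data.Rational using (ℚ; _/_; 0ℚ) renaming (_≤_ to _≤ℚ_; _*_ to _*ℚ_)
open import Data.Product using (_×_; _,_; Σ-syntax)
open import Data.List using (List; []; _∷_)
open import Data.List.Relation.Unary.All using (All)
open import Data.List.Relation.Binary.Permutation.Propositional using (_↭_)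
open import Relation.Binary.PropositionalEquality using (_≡_; _≢_)

ℤ² : Set
ℤ² = ℤ × ℤ

zero² : ℤ²
zero² = (+ 0 , + 0)

_⊕_ : ℤ² → ℤ² → ℤ²
(d₁ , c₁) ⊕ (d₂ , c₂) = (d₁ +ℤ d₂ , c₁ +ℤ c₂)

sum² : List ℤ² → ℤ²
sum² []       = zero²
sum² (x ∷ xs) = x ⊕ sum² xs

InM : ℚ → ℤ² → Set
InM α (d , c) = (+ 0 ≤ c) × ((c / 1) ≤ℚ (α *ℚ (d / 1))) × (c ≢ + 1)

Irreducible : ℚ → ℤ² → Set
Irreducible α x =
  InM α x × (x ≢ zero²) ×
  (∀ y z → InM α y → InM α z → y ≢ zero² → z ≢ zero² → y ⊕ z ≢ x)

AtomicDecomposition : ℚ → ℤ² → List ℤ² → Set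
AtomicDecomposition α x xs = All (Irreducible α) xs × (sum² xs ≡ x)

UniqueAtomic : ℚ → ℤ² → Set
UniqueAtomic α x =
  Σ[ xs ∈ List ℤ² ] (AtomicDecomposition α x xs ×
    (∀ ys → AtomicDecomposition α x ys → ys ↭ xs))

-- Write α = (p+1)/(q+1). Every element of M is ⟨ a , b ⟩ = (+ a , + b) with b(q+1) ≤ (p+1)a and
-- b ≠ 1, and it is nonzero iff a ≠ 0; call b its height. Heights can be lowered inside M (keeping
-- them ≠ 1). So if ⟨D,C⟩ is irreducible and ⟨D,C′⟩ = y + z with y, z nonzero and C′ > C, the
-- heights of y and z cannot be lowered to values summing to C, and a little arithmetic shows this
-- forces C = 3 with y, z both of height 2. Hence ⟨D,C′⟩ is irreducible, and so uniquely atomic,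
-- unless C′ = 4 and ⟨D,4⟩ = ⟨k,2⟩ + ⟨k′,2⟩ in M. In that case every atomic decomposition of ⟨D,4⟩
-- consists of two elements of height 2 (a third summand would have height 0), and the splitting of
-- D is unique: if ⟨e,2⟩ + ⟨e′,2⟩ is another one with e < k, then ⟨k−e,0⟩ + (⟨e,2⟩ + ⟨k′,2⟩) is a
-- decomposition of ⟨D,4⟩ with a nonzero summand of height 0.
module Submission where

open import Defs
open import Data.Integer using (ℤ; _<_)
open import Data.Rational using (ℚ; 0ℚ) renaming (_<_ to _<ℚ_)
open import Data.Product using (_,_)

open import Data.Empty using (⊥-elim)
open import Data.Fin using (Fin; toℕ; fromℕ<)
import Data.Fin.Properties as Fin
open import Data.Integer as ℤ using (+_; -[1+_]; +≤+; +<+)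
import Data.Integer.Properties as ℤP
open import Data.List using (List; []; _∷_; [_])
open import Data.List.Relation.Unary.All as All using (All; []; _∷_)
open import Data.List.Relation.Binary.Permutation.Propositional using (_↭_; ↭-reflexive)
open import Data.Nat as ℕ using (ℕ; zero; suc; _+_; _*_; _∸_; _≤_; z≤n; s≤s; _≤?_; _≟_)
open import Data.Nat.Coprimality using (Coprime)
open import Data.Nat.Properties
open import Data.Product using (∃; ∃₂; _×_; proj₁; proj₂)
open import Data.Rational as ℚ using (mkℚ; _/_; ↥_; ↧_; toℚᵘ)
import Data.Rational.Properties as ℚP
import Data.Rational.Unnormalised as ℚᵘ
import Data.Rational.Unnormalised.Properties as ℚᵘP
open import Data.Sum using (_⊎_; inj₁; inj₂)
open import Function.Base using (_∘_)
open import Function.Bundles using (_⇔_; mk⇔; Equivalence)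
open import Relation.Binary.PropositionalEquality hiding ([_])
open import Relation.Nullary using (¬_; Dec; yes; no; ¬?; _×-dec_)
open import Relation.Nullary.Decidable using (map′)

private
  variable
    a a′ b b′ C′ : ℕ
    x : ℤ²

record SplitUnder (C b b′ : ℕ) : Set where
  constructor split
  field
    {c c′} : ℕ
    c≤b    : c ≤ b
    c′≤b′  : c′ ≤ b′
    c≢1    : c ≢ 1
    c′≢1   : c′ ≢ 1
    c+c′≡C : c + c′ ≡ C

split-under-+ : ∀ b r → b ≢ 1 → b + r ≢ 1 → r ℕ.< b′ → b′ ℕ.< b + r →
                SplitUnder (b + r) b b′ ⊎ (b + r ≡ 3 × b ≡ 2 × b′ ≡ 2)
split-under-+ b zero          b≢1 _ _    _ = inj₁ (split ≤-refl z≤n b≢1 (λ ()) refl)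
split-under-+ b (suc (suc r)) b≢1 _ r<b′ _ = inj₁ (split ≤-refl (<⇒≤ r<b′) b≢1 (λ ()) refl)
split-under-+ 0 1 _   C≢1 _ _ = ⊥-elim (C≢1 refl)
split-under-+ 1 1 b≢1 _   _ _ = ⊥-elim (b≢1 refl)
split-under-+ 2 1 _   _   1<b′ b′<3 = inj₂ (refl , refl , ≤-antisym (ℕ.s≤s⁻¹ b′<3) 1<b′)
split-under-+ (suc (suc (suc t))) 1 _ _ 1<b′ _ =
  inj₁ (split (n≤1+n (2 + t)) 1<b′ (λ ()) (λ ()) (cong (λ n → 2 + n) (+-suc t 1)))

split-under : ∀ C b b′ → C ≢ 1 → b ≢ 1 → C ℕ.< b + b′ →
              SplitUnder C b b′ ⊎ (C ≡ 3 × b ≡ 2 × b′ ≡ 2)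
split-under C b b′ C≢1 b≢1 C<b+b′ with C ≤? b | C ≤? b′
... | yes C≤b | _        = inj₁ (split C≤b z≤n C≢1 (λ ()) (+-identityʳ C))
... | no _    | yes C≤b′ = inj₁ (split z≤n C≤b′ (λ ()) C≢1 refl)
... | no C≰b  | no C≰b′ with m≤n⇒∃[o]m+o≡n (<⇒≤ (≰⇒> C≰b))
...   | r , refl = split-under-+ b r b≢1 C≢1 (+-cancelˡ-< b r b′ C<b+b′) (≰⇒> C≰b′)

⟨_,_⟩ : ℕ → ℕ → ℤ²
⟨ a , b ⟩ = (+ a , + b)

⟨,⟩-injective : ⟨ a , b ⟩ ≡ ⟨ a′ , b′ ⟩ → a ≡ a′ × b ≡ b′
⟨,⟩-injective refl = refl , refl

⟨,⟩≢zero² : a ≢ 0 → ⟨ a , b ⟩ ≢ zero²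
⟨,⟩≢zero² a≢0 eq = a≢0 (ℤP.+-injective (cong proj₁ eq))

⊕-identityʳ : ∀ x → x ⊕ zero² ≡ x
⊕-identityʳ (d , c) = cong₂ _,_ (ℤP.+-identityʳ d) (ℤP.+-identityʳ c)

⊕-comm : ∀ x y → x ⊕ y ≡ y ⊕ x
⊕-comm (d , c) (d′ , c′) = cong₂ _,_ (ℤP.+-comm d d′) (ℤP.+-comm c c′)

⊕-assoc : ∀ x y z → (x ⊕ y) ⊕ z ≡ x ⊕ (y ⊕ z)
⊕-assoc (d , c) (d′ , c′) (d″ , c″) = cong₂ _,_ (ℤP.+-assoc d d′ d″) (ℤP.+-assoc c c′ c″)

⊕-swap : ∀ x y z → x ⊕ (y ⊕ z) ≡ y ⊕ (x ⊕ z)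
⊕-swap x y z = begin
  x ⊕ (y ⊕ z)  ≡⟨ ⊕-assoc x y z ⟨
  (x ⊕ y) ⊕ z  ≡⟨ cong (_⊕ z) (⊕-comm x y) ⟩
  (y ⊕ x) ⊕ z  ≡⟨ ⊕-assoc y x z ⟩
  y ⊕ (x ⊕ z)  ∎
  where open ≡-Reasoning

/1≤*/1⇔ : ∀ α i j → (i / 1 ℚ.≤ α ℚ.* (j / 1)) ⇔ (i ℤ.* ↧ α ℤ.≤ ↥ α ℤ.* j)
/1≤*/1⇔ α@(mkℚ _ d-1 _) i j = mk⇔ to from
  where
  i/1≃ : toℚᵘ (i / 1) ℚᵘ.≃ ℚᵘ.mkℚᵘ i 0
  i/1≃ = ℚP.toℚᵘ-fromℚᵘ (ℚᵘ.mkℚᵘ i 0)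
  α*j/1≃ : toℚᵘ (α ℚ.* (j / 1)) ℚᵘ.≃ toℚᵘ α ℚᵘ.* ℚᵘ.mkℚᵘ j 0
  α*j/1≃ = ℚᵘP.≃-trans (ℚP.toℚᵘ-homo-* α (j / 1))
                       (ℚᵘP.*-congˡ {toℚᵘ α} (ℚP.toℚᵘ-fromℚᵘ (ℚᵘ.mkℚᵘ j 0)))
  ↧α≡ : + suc (d-1 * 1) ≡ ↧ α
  ↧α≡ = cong (λ n → + suc n) (*-identityʳ d-1)
  to : i / 1 ℚ.≤ α ℚ.* (j / 1) → i ℤ.* ↧ α ℤ.≤ ↥ α ℤ.* j
  to i≤αj with ℚᵘP.≤-respʳ-≃ α*j/1≃ (ℚᵘP.≤-respˡ-≃ i/1≃ (ℚP.toℚᵘ-mono-≤ i≤αj))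
  ... | ℚᵘ.*≤* i↧≤↥j = subst₂ ℤ._≤_ (cong (i ℤ.*_) ↧α≡) (ℤP.*-identityʳ _) i↧≤↥j
  from : i ℤ.* ↧ α ℤ.≤ ↥ α ℤ.* j → i / 1 ℚ.≤ α ℚ.* (j / 1)
  from i↧≤↥j = ℚP.toℚᵘ-cancel-≤ (ℚᵘP.≤-respʳ-≃ (ℚᵘP.≃-sym α*j/1≃) (ℚᵘP.≤-respˡ-≃ (ℚᵘP.≃-sym i/1≃)
    (ℚᵘ.*≤* (subst₂ ℤ._≤_ (cong (i ℤ.*_) (sym ↧α≡)) (sym (ℤP.*-identityʳ _)) i↧≤↥j))))

InM? : ∀ α x → Dec (InM α x)
InM? α (d , c) = (+ 0 ℤ.≤? c) ×-dec (c / 1 ℚ.≤? α ℚ.* (d / 1)) ×-dec ¬? (c ℤ.≟ + 1)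

module _ (p q : ℕ) .(cop : Coprime (suc p) (suc q)) where

  private
    α : ℚ
    α = mkℚ (+ suc p) q cop

    /1≤α*/1⇔ : ∀ j → (+ b / 1 ℚ.≤ α ℚ.* (j / 1)) ⇔ (+ (b * suc q) ℤ.≤ + suc p ℤ.* j)
    /1≤α*/1⇔ {b} j = subst (λ i → (+ b / 1 ℚ.≤ α ℚ.* (j / 1)) ⇔ (i ℤ.≤ + suc p ℤ.* j))
                           (sym (ℤP.pos-* b (suc q))) (/1≤*/1⇔ α (+ b) j)

  Below : ℕ → ℕ → Set
  Below a b = b * suc q ≤ suc p * a

  InM-view : ∀ x → InM α x → ∃₂ λ a b → x ≡ ⟨ a , b ⟩
  InM-view (_ , -[1+ _ ]) (() , _)
  InM-view (-[1+ n ] , + b) (_ , b≤αd , _) with Equivalence.to (/1≤α*/1⇔ {b} -[1+ n ]) b≤αd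
  ... | ()
  InM-view (+ a , + b) _ = a , b , refl

  InM⇒Below : InM α ⟨ a , b ⟩ → Below a b
  InM⇒Below {a} {b} (_ , b≤αa , _) =
    ℤP.drop‿+≤+ (subst (+ (b * suc q) ℤ.≤_) (sym (ℤP.pos-* (suc p) a))
                       (Equivalence.to (/1≤α*/1⇔ {b} (+ a)) b≤αa))

  InM⇒≢1 : InM α ⟨ a , b ⟩ → b ≢ 1
  InM⇒≢1 (_ , _ , b≢1) = b≢1 ∘ cong (+_)

  Below⇒InM : Below a b → b ≢ 1 → InM α ⟨ a , b ⟩
  Below⇒InM {a} {b} below b≢1 =
    +≤+ z≤n ,
    Equivalence.from (/1≤α*/1⇔ {b} (+ a)) (subst (+ (b * suc q) ℤ.≤_) (ℤP.pos-* (suc p) a) (+≤+ below)) ,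
    b≢1 ∘ ℤP.+-injective

  InM-flat : ∀ a → InM α ⟨ a , 0 ⟩
  InM-flat a = Below⇒InM {a} z≤n (λ ())

  InM-lower : b′ ≤ b → b′ ≢ 1 → InM α ⟨ a , b ⟩ → InM α ⟨ a , b′ ⟩
  InM-lower {a = a} b′≤b b′≢1 ab∈M =
    Below⇒InM (≤-trans (*-monoˡ-≤ (suc q) b′≤b) (InM⇒Below {a} ab∈M)) b′≢1

  InM-⊕ : ∀ x y → InM α x → InM α y → InM α (x ⊕ y)
  InM-⊕ x y x∈M y∈M with InM-view x x∈M | InM-view y y∈M
  ... | a , b , refl | a′ , b′ , refl = Below⇒InM below (+≢1 b b′ (InM⇒≢1 {a} x∈M) (InM⇒≢1 {a′} y∈M))
    where
    below : Below (a + a′) (b + b′)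
    below = subst₂ _≤_ (sym (*-distribʳ-+ (suc q) b b′)) (sym (*-distribˡ-+ (suc p) a a′))
                   (+-mono-≤ (InM⇒Below {a} x∈M) (InM⇒Below {a′} y∈M))
    +≢1 : ∀ b b′ → b ≢ 1 → b′ ≢ 1 → b + b′ ≢ 1
    +≢1 0             _ _   b′≢1 = b′≢1
    +≢1 1             _ b≢1 _    = ⊥-elim (b≢1 refl)
    +≢1 (suc (suc _)) _ _   _    ()

  InM-nonzero : InM α ⟨ a , b ⟩ → ⟨ a , b ⟩ ≢ zero² → a ≢ 0
  InM-nonzero {b = b} ab∈M ab≢0 refl = ab≢0 (cong (λ n → ⟨ 0 , n ⟩) (n≤0⇒n≡0 b≤0))
    where
    b≤0 : b ≤ 0
    b≤0 = ≤-trans (m≤m*n b (suc q)) (≤-trans (InM⇒Below {0} ab∈M) (≤-reflexive (*-zeroʳ (suc p))))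

  ⊕-nonzero : ∀ x y → InM α x → InM α y → x ≢ zero² → x ⊕ y ≢ zero²
  ⊕-nonzero x y x∈M y∈M x≢0 with InM-view x x∈M | InM-view y y∈M
  ... | a , _ , refl | _ , _ , refl = ⟨,⟩≢zero² (InM-nonzero {a} x∈M x≢0 ∘ m+n≡0⇒m≡0 a)

  sum²-InM : ∀ {xs} → All (InM α) xs → InM α (sum² xs)
  sum²-InM []                      = InM-flat 0
  sum²-InM {x ∷ xs} (x∈M ∷ xs∈M) = InM-⊕ x (sum² xs) x∈M (sum²-InM xs∈M)

  sum²-nonzero : ∀ {x xs} → All (Irreducible α) (x ∷ xs) → sum² (x ∷ xs) ≢ zero²
  sum²-nonzero {x} {xs} ((x∈M , x≢0 , _) ∷ atoms) =
    ⊕-nonzero x (sum² xs) x∈M (sum²-InM (All.map proj₁ atoms)) x≢0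

  Irreducible⇒UniqueAtomic : Irreducible α x → UniqueAtomic α x
  Irreducible⇒UniqueAtomic {x} x-irr@(_ , x≢0 , indecomposable) =
    [ x ] , (x-irr ∷ [] , ⊕-identityʳ x) , unique
    where
    unique : ∀ ys → AtomicDecomposition α x ys → ys ↭ [ x ]
    unique []       (_ , zero²≡x)      = ⊥-elim (x≢0 (sym zero²≡x))
    unique (y ∷ []) (_ , y⊕zero²≡x) = ↭-reflexive (cong [_] (trans (sym (⊕-identityʳ y)) y⊕zero²≡x))
    unique (y ∷ z ∷ zs) ((y∈M , y≢0 , _) ∷ atoms , y⊕rest≡x) =
      ⊥-elim (indecomposable y (sum² (z ∷ zs)) y∈M (sum²-InM (All.map proj₁ atoms)) y≢0
                             (sum²-nonzero atoms) y⊕rest≡x)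

  record Halving (D : ℕ) : Set where
    constructor halving
    field
      k k′   : ℕ
      k+k′≡D : k + k′ ≡ D
      k∈M    : InM α ⟨ k , 2 ⟩
      k′∈M   : InM α ⟨ k′ , 2 ⟩

  halves : ∀ {D} → Halving D → List ℤ²
  halves (halving k k′ _ _ _) = ⟨ k , 2 ⟩ ∷ ⟨ k′ , 2 ⟩ ∷ []

  halving-swap : ∀ {D} → Halving D → Halving D
  halving-swap (halving k k′ k+k′≡D k∈M k′∈M) = halving k′ k (trans (+-comm k′ k) k+k′≡D) k′∈M k∈M

  halving? : ∀ D → Dec (Halving D)
  halving? D = map′ from to (Fin.any? λ i → InM? α ⟨ toℕ i , 2 ⟩ ×-dec InM? α ⟨ D ∸ toℕ i , 2 ⟩)
    where
    Halves : ℕ → Set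
    Halves k = InM α ⟨ k , 2 ⟩ × InM α ⟨ D ∸ k , 2 ⟩
    from : ∃ (λ (i : Fin (suc D)) → Halves (toℕ i)) → Halving D
    from (i , k∈M , k′∈M) = halving (toℕ i) (D ∸ toℕ i) (m+[n∸m]≡n (Fin.toℕ≤pred[n] i)) k∈M k′∈M
    to : Halving D → ∃ (λ (i : Fin (suc D)) → Halves (toℕ i))
    to (halving k k′ refl k∈M k′∈M) =
      fromℕ< k<1+D , subst Halves (sym (Fin.toℕ-fromℕ< k<1+D))
                           (k∈M , subst (λ n → InM α ⟨ n , 2 ⟩) (sym (m+n∸m≡n k k′)) k′∈M)
      where
      k<1+D : k ℕ.< suc (k + k′)
      k<1+D = s≤s (m≤m+n k k′)

  module _ {D C : ℕ} (irr : Irreducible α ⟨ D , C ⟩) where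

    summand-height : C ℕ.< C′ → ∀ x y → InM α x → InM α y → x ≢ zero² → y ≢ zero² →
                     x ⊕ y ≡ ⟨ D , C′ ⟩ → proj₂ x ≡ + 2
    summand-height C<C′ x y x∈M y∈M x≢0 y≢0 x⊕y≡ with InM-view x x∈M | InM-view y y∈M
    ... | a , b , refl | a′ , b′ , refl with ⟨,⟩-injective x⊕y≡
    ...   | a+a′≡D , refl with split-under C b b′ (InM⇒≢1 {D} (proj₁ irr)) (InM⇒≢1 {a} x∈M) C<C′
    ...     | inj₂ (_ , b≡2 , _) = cong +_ b≡2
    ...     | inj₁ (split c≤b c′≤b′ c≢1 c′≢1 c+c′≡C) =
      ⊥-elim (proj₂ (proj₂ irr) ⟨ a , _ ⟩ ⟨ a′ , _ ⟩
                (InM-lower {a = a} c≤b c≢1 x∈M) (InM-lower {a = a′} c′≤b′ c′≢1 y∈M)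
                (⟨,⟩≢zero² (InM-nonzero {a} x∈M x≢0)) (⟨,⟩≢zero² (InM-nonzero {a′} y∈M y≢0))
                (cong₂ ⟨_,_⟩ a+a′≡D c+c′≡C))

    irreducible-above : C ℕ.< C′ → InM α ⟨ D , C′ ⟩ → ¬ (C′ ≡ 4 × Halving D) →
                        Irreducible α ⟨ D , C′ ⟩
    irreducible-above C<C′@(s≤s _) DC′∈M not-halved = DC′∈M , (λ ()) , indecomposable
      where
      indecomposable : ∀ y z → InM α y → InM α z → y ≢ zero² → z ≢ zero² → y ⊕ z ≢ ⟨ D , _ ⟩
      indecomposable y z y∈M z∈M y≢0 z≢0 y⊕z≡ with InM-view y y∈M | InM-view z z∈M
      ... | a , b , refl | a′ , b′ , refl
        with summand-height C<C′ ⟨ a , b ⟩ ⟨ a′ , b′ ⟩ y∈M z∈M y≢0 z≢0 y⊕z≡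
           | summand-height C<C′ ⟨ a′ , b′ ⟩ ⟨ a , b ⟩ z∈M y∈M z≢0 y≢0
                            (trans (⊕-comm ⟨ a′ , b′ ⟩ ⟨ a , b ⟩) y⊕z≡)
      ...   | refl | refl with ⟨,⟩-injective y⊕z≡
      ...     | a+a′≡D , refl = not-halved (refl , halving a a′ a+a′≡D y∈M z∈M)

    module _ (C<4 : C ℕ.< 4) where

      summands-height : ∀ y z w → InM α y → InM α z → InM α w → y ≢ zero² → z ≢ zero² →
                        y ⊕ (z ⊕ w) ≡ ⟨ D , 4 ⟩ → proj₂ y ≡ + 2 × proj₂ z ≡ + 2
      summands-height y z w y∈M z∈M w∈M y≢0 z≢0 y⊕z⊕w≡ =
        summand-height C<4 y (z ⊕ w) y∈M (InM-⊕ z w z∈M w∈M) y≢0 (⊕-nonzero z w z∈M w∈M z≢0) y⊕z⊕w≡ ,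
        summand-height C<4 z (y ⊕ w) z∈M (InM-⊕ y w y∈M w∈M) z≢0 (⊕-nonzero y w y∈M w∈M y≢0)
                       (trans (⊕-swap z y w) y⊕z⊕w≡)

      halving-≮ : (h h′ : Halving D) → ¬ (Halving.k h ℕ.< Halving.k h′)
      halving-≮ (halving e _ _ e∈M _) (halving k k′ k+k′≡D _ k′∈M) e<k with m≤n⇒∃[o]m+o≡n e<k
      ... | t , 1+e+t≡k =
        flat≢2 (summand-height C<4 ⟨ suc t , 0 ⟩ (⟨ e , 2 ⟩ ⊕ ⟨ k′ , 2 ⟩)
                               (InM-flat (suc t)) (InM-⊕ ⟨ e , 2 ⟩ ⟨ k′ , 2 ⟩ e∈M k′∈M) (λ ()) (λ ())
                               (cong (λ n → ⟨ n , 4 ⟩) 1+t+e+k′≡D))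
        where
        flat≢2 : + 0 ≢ + 2
        flat≢2 ()
        1+t+e+k′≡D : suc t + (e + k′) ≡ D
        1+t+e+k′≡D = begin
          suc t + (e + k′)  ≡⟨ +-assoc (suc t) e k′ ⟨
          suc t + e + k′    ≡⟨ cong (λ n → suc n + k′) (+-comm t e) ⟩
          suc e + t + k′    ≡⟨ cong (_+ k′) 1+e+t≡k ⟩
          k + k′            ≡⟨ k+k′≡D ⟩
          D                 ∎
          where open ≡-Reasoning

      halving-unique : (h h′ : Halving D) → halves h ≡ halves h′
      halving-unique h@(halving k k′ k+k′≡D _ _) h′@(halving e e′ e+e′≡D _ _) =
        cong₂ (λ m n → ⟨ m , 2 ⟩ ∷ ⟨ n , 2 ⟩ ∷ []) k≡e
              (+-cancelˡ-≡ e k′ e′ (trans (subst (λ m → m + k′ ≡ D) k≡e k+k′≡D) (sym e+e′≡D)))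
        where
        k≡e : k ≡ e
        k≡e = ≤-antisym (≮⇒≥ (halving-≮ h′ h)) (≮⇒≥ (halving-≮ h h′))

      halving-irreducible : (h : Halving D) → Irreducible α ⟨ Halving.k h , 2 ⟩
      halving-irreducible (halving k k′ k+k′≡D k∈M k′∈M) = k∈M , (λ ()) , indecomposable
        where
        indecomposable : ∀ y z → InM α y → InM α z → y ≢ zero² → z ≢ zero² → y ⊕ z ≢ ⟨ k , 2 ⟩
        indecomposable y z y∈M z∈M y≢0 z≢0 y⊕z≡ =
          let hy , hz = summands-height y z ⟨ k′ , 2 ⟩ y∈M z∈M k′∈M y≢0 z≢0 y⊕z⊕k′≡
          in 4≢2 (trans (cong₂ ℤ._+_ (sym hy) (sym hz)) (cong proj₂ y⊕z≡))
          where
          4≢2 : + 4 ≢ + 2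
          4≢2 ()
          y⊕z⊕k′≡ : y ⊕ (z ⊕ ⟨ k′ , 2 ⟩) ≡ ⟨ D , 4 ⟩
          y⊕z⊕k′≡ = trans (sym (⊕-assoc y z ⟨ k′ , 2 ⟩))
                          (trans (cong (_⊕ ⟨ k′ , 2 ⟩) y⊕z≡) (cong (λ n → ⟨ n , 4 ⟩) k+k′≡D))

      decomposition⇒halves : Halving D → ∀ ys → AtomicDecomposition α ⟨ D , 4 ⟩ ys →
                             ∃ λ (h : Halving D) → ys ≡ halves h
      decomposition⇒halves _ [] (_ , ())
      decomposition⇒halves (halving k k′ k+k′≡D k∈M k′∈M) (y ∷ [])
                           ((_ , _ , indecomposable) ∷ [] , y⊕zero²≡) =
        ⊥-elim (indecomposable ⟨ k , 2 ⟩ ⟨ k′ , 2 ⟩ k∈M k′∈M (λ ()) (λ ())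
                  (trans (cong (λ n → ⟨ n , 4 ⟩) k+k′≡D) (trans (sym y⊕zero²≡) (⊕-identityʳ y))))
      decomposition⇒halves _ (y ∷ z ∷ []) ((y∈M , y≢0 , _) ∷ (z∈M , z≢0 , _) ∷ [] , y⊕z⊕zero²≡)
        with InM-view y y∈M | InM-view z z∈M
      ... | a , b , refl | a′ , b′ , refl
        with summands-height ⟨ a , b ⟩ ⟨ a′ , b′ ⟩ zero² y∈M z∈M (InM-flat 0) y≢0 z≢0 y⊕z⊕zero²≡
      ...   | refl , refl = halving a a′ a+a′≡D y∈M z∈M , refl
        where
        a+a′≡D : a + a′ ≡ D
        a+a′≡D = trans (cong (λ n → a + n) (sym (+-identityʳ a′))) (proj₁ (⟨,⟩-injective y⊕z⊕zero²≡))
      decomposition⇒halves _ (y ∷ z ∷ u ∷ us) ((y∈M , y≢0 , _) ∷ (z∈M , z≢0 , _) ∷ rest , y⊕z⊕w≡) =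
        let hy , hz = summands-height y z w y∈M z∈M w∈M y≢0 z≢0 y⊕z⊕w≡
        in ⊥-elim (6≢4 (trans (cong₂ ℤ._+_ (sym hy) (cong₂ ℤ._+_ (sym hz) (sym hw))) (cong proj₂ y⊕z⊕w≡)))
        where
        6≢4 : + 6 ≢ + 4
        6≢4 ()
        w : ℤ²
        w = sum² (u ∷ us)
        w∈M : InM α w
        w∈M = sum²-InM (All.map proj₁ rest)
        hw : proj₂ w ≡ + 2
        hw = summand-height C<4 w (y ⊕ z) w∈M (InM-⊕ y z y∈M z∈M) (sum²-nonzero rest)
                            (⊕-nonzero y z y∈M z∈M y≢0)
                            (trans (⊕-comm w (y ⊕ z)) (trans (⊕-assoc y z w) y⊕z⊕w≡))

      Halving⇒UniqueAtomic : Halving D → UniqueAtomic α ⟨ D , 4 ⟩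
      Halving⇒UniqueAtomic h@(halving k k′ k+k′≡D _ _) =
        halves h , (halving-irreducible h ∷ halving-irreducible (halving-swap h) ∷ [] , sum≡) , unique
        where
        sum≡ : sum² (halves h) ≡ ⟨ D , 4 ⟩
        sum≡ = cong (λ n → ⟨ n , 4 ⟩) (trans (cong (λ n → k + n) (+-identityʳ k′)) k+k′≡D)
        unique : ∀ ys → AtomicDecomposition α ⟨ D , 4 ⟩ ys → ys ↭ halves h
        unique ys ys-decomposes =
          let h′ , ys≡halves-h′ = decomposition⇒halves h ys ys-decomposes
          in ↭-reflexive (trans ys≡halves-h′ (halving-unique h′ h))

  unique-atomic-above : ∀ d c → Irreducible α (d , c) → ∀ c′ → InM α (d , c′) → c < c′ →
                        UniqueAtomic α (d , c′)
  unique-atomic-above d c irr c′ dc′∈M c<c′ with InM-view (d , c) (proj₁ irr) | InM-view (d , c′) dc′∈M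
  ... | D , C , refl | _ , C′ , refl with ℤP.drop‿+<+ c<c′ | C′ ≟ 4 | halving? D
  ... | C<C′ | yes refl | yes h = Halving⇒UniqueAtomic irr C<C′ h
  ... | C<C′ | no C′≢4  | _     = Irreducible⇒UniqueAtomic (irreducible-above irr C<C′ dc′∈M (C′≢4 ∘ proj₁))
  ... | C<C′ | yes _    | no ¬h = Irreducible⇒UniqueAtomic (irreducible-above irr C<C′ dc′∈M (¬h ∘ proj₂))

lemma2p5 : (α : ℚ) → 0ℚ <ℚ α → (d c : ℤ) → Irreducible α (d , c) →
    (c′ : ℤ) → InM α (d , c′) → c < c′ → UniqueAtomic α (d , c′)
lemma2p5 (mkℚ (+ suc p) q cop) _ = unique-atomic-above p q cop
lemma2p5 (mkℚ (+ zero) _ _) (ℚ.*<* (+<+ ()))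
lemma2p5 (mkℚ -[1+ _ ] _ _) (ℚ.*<* ())
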